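{- Let $H$ and $F$ be $r$-uniform hypergraphs. A mapping $f : V(H) \to V(F)$ is a homomorphism if and only if $f^{ -1}(I) \in \hat{i}(H)$ for every $I \in i(F)$.
   Context: A hypergraph has a finite vertex set and a set of subsets (edges); it is $r$-uniform if all edges have size $r$. A set of vertices is independent if it contains no edge. $\hat{i}(H)$ is the set of all independent sets of $H$ and $i(H)$ the set of all inclusion-maximal independent sets of $H$. A map $f : V(H) \to V(F)$ is a homomorphism if for every edge $h$ of $H$, the image $f(h)$ is an edge of $F$. -}

module Defs where

open import Data.Nat using (ℕ)
open import Data.Fin using (Fin)
open import Data.Fin.Properties using (any?; _≟_)
open import Data.Fin.Subset using (Subset; _∈_; _⊆_; ∣_∣)
open import Data.Fin.Subset.Properties using (_∈?_)
open import Data.Vec using (tabulate; lookup)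
open import Data.List using (List)
open import Data.List.Membership.Propositional using () renaming (_∈_ to _∈ₗ_)
open import Data.Product using (_×_)
open import Relation.Nullary using (¬_; ⌊_⌋)
open import Relation.Nullary.Decidable using (_×-dec_)
open import Relation.Binary.PropositionalEquality using (_≡_)

record Hypergraph : Set where
  field
    n     : ℕ
    edges : List (Subset n)
open Hypergraph public

V : Hypergraph → Set
V H = Fin (n H)

IsEdge : (H : Hypergraph) → Subset (n H) → Set
IsEdge H e = e ∈ₗ edges H

Uniform : ℕ → Hypergraph → Set
Uniform r H = ∀ e → IsEdge H e → ∣ e ∣ ≡ r

image : ∀ {a b} → (Fin a → Fin b) → Subset a → Subset b
image f S = tabulate λ y → ⌊ any? (λ x → (x ∈? S) ×-dec (f x ≟ y)) ⌋

preimage : ∀ {a b} → (Fin a → Fin b) → Subset b → Subset a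
preimage f I = tabulate λ x → lookup I (f x)

IsHomomorphism : (H F : Hypergraph) → (V H → V F) → Set
IsHomomorphism H F f = ∀ h → IsEdge H h → IsEdge F (image f h)

-- S ∈ î(H): S contains no edge of H
Independent : (H : Hypergraph) → Subset (n H) → Set
Independent H S = ∀ e → IsEdge H e → ¬ (e ⊆ S)

-- S ∈ i(H): inclusion-maximal independent set
MaximalIndependent : (H : Hypergraph) → Subset (n H) → Set
MaximalIndependent H S =
  Independent H S × (∀ T → Independent H T → S ⊆ T → T ≡ S)

-- A homomorphism pulls independent sets of F back to independent sets of H, since an edge
-- inside f⁻¹(I) would be mapped onto an edge inside I.  Conversely, if an edge h of H has
-- an image f(h) that is not an edge of F, then f(h) has at most r vertices, so it contains
-- no edge of the r-uniform F and is independent; extending it to a maximal independent set I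
-- gives h ⊆ f⁻¹(I), so f⁻¹(I) is not independent.
module Submission where

open import Defs
import Data.Bool.Properties as Bool
open import Data.Empty using (⊥-elim)
open import Data.Fin using (Fin; zero; suc)
open import Data.Fin.Properties using (any?)
open import Data.Fin.Subset
  using (Subset; _∈_; _∉_; _⊆_; _⊃_; ∣_∣; _∪_; ⁅_⁆; ⊥; inside; outside)
open import Data.Fin.Subset.Properties
  using (_∈?_; _⊆?_; ⊆-antisym; p⊆q⇒∣p∣≤∣q∣; drop-∷-⊆; ∣⊥∣≡0; ∣⁅x⁆∣≡1;
         p⊆p∪q; q⊆p∪q; x∈p∪q⁻; x∈⁅x⁆; x∈⁅y⁆⇒x≡y)
open import Data.Fin.Subset.Induction using (⊃-wellFounded)
import Data.List.Membership.DecPropositional as ListMembership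
open import Data.List.Relation.Unary.All as All using (all?)
open import Data.Nat using (ℕ; suc; _+_; _≤_; z≤n; s≤s; s≤s⁻¹)
open import Data.Nat.Properties using (≤-trans; n≤1+n; +-suc; +-monoʳ-≤; <⇒≱; module ≤-Reasoning)
open import Data.Product using (_×_; _,_; ∃)
open import Data.Sum using (inj₁; inj₂)
open import Data.Vec using ([]; _∷_; here; there)
open import Data.Vec.Properties using (lookup∘tabulate; []=⇒lookup; lookup⇒[]=; ≡-dec)
open import Function using (_∘_)
open import Function.Bundles using (_⇔_; mk⇔; Equivalence)
open import Induction.WellFounded using (Acc; acc)
open import Relation.Nullary using (¬_; ¬?; Dec; yes; no)
open import Relation.Nullary.Decidable using (fromWitness; toWitness; map′; decidable-stable; _×-dec_)
open import Relation.Binary.PropositionalEquality using (_≡_; refl; sym; trans; subst; cong)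

module _ {a b : ℕ} (f : Fin a → Fin b) where

  ∈-image⁺ : ∀ {S x} → x ∈ S → f x ∈ image f S
  ∈-image⁺ {S} {x} x∈S = lookup⇒[]= (f x) _
    (trans (lookup∘tabulate _ (f x)) (Equivalence.to Bool.T-≡ (fromWitness (x , x∈S , refl))))

  ∈-image⁻ : ∀ {S y} → y ∈ image f S → ∃ λ x → x ∈ S × f x ≡ y
  ∈-image⁻ {S} {y} y∈ =
    toWitness (Equivalence.from Bool.T-≡ (trans (sym (lookup∘tabulate _ y)) ([]=⇒lookup y∈)))

  ∈-preimage⁺ : ∀ {I x} → f x ∈ I → x ∈ preimage f I
  ∈-preimage⁺ {I} {x} fx∈I = lookup⇒[]= x _ (trans (lookup∘tabulate _ x) ([]=⇒lookup fx∈I))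

  ∈-preimage⁻ : ∀ {I x} → x ∈ preimage f I → f x ∈ I
  ∈-preimage⁻ {I} {x} x∈ = lookup⇒[]= (f x) I (trans (sym (lookup∘tabulate _ x)) ([]=⇒lookup x∈))

  image⊆⇒⊆preimage : ∀ {S I} → image f S ⊆ I → S ⊆ preimage f I
  image⊆⇒⊆preimage fS⊆I x∈S = ∈-preimage⁺ (fS⊆I (∈-image⁺ x∈S))

  ⊆preimage⇒image⊆ : ∀ {S I} → S ⊆ preimage f I → image f S ⊆ I
  ⊆preimage⇒image⊆ S⊆f⁻¹I y∈ with ∈-image⁻ y∈
  ... | x , x∈S , refl = ∈-preimage⁻ (S⊆f⁻¹I x∈S)

∣p∪q∣≤∣p∣+∣q∣ : ∀ {m} (p q : Subset m) → ∣ p ∪ q ∣ ≤ ∣ p ∣ + ∣ q ∣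
∣p∪q∣≤∣p∣+∣q∣ []            []            = z≤n
∣p∪q∣≤∣p∣+∣q∣ (outside ∷ p) (outside ∷ q) = ∣p∪q∣≤∣p∣+∣q∣ p q
∣p∪q∣≤∣p∣+∣q∣ (outside ∷ p) (inside  ∷ q) =
  subst (suc ∣ p ∪ q ∣ ≤_) (sym (+-suc ∣ p ∣ ∣ q ∣)) (s≤s (∣p∪q∣≤∣p∣+∣q∣ p q))
∣p∪q∣≤∣p∣+∣q∣ (inside  ∷ p) (outside ∷ q) = s≤s (∣p∪q∣≤∣p∣+∣q∣ p q)
∣p∪q∣≤∣p∣+∣q∣ (inside  ∷ p) (inside  ∷ q) =
  s≤s (≤-trans (∣p∪q∣≤∣p∣+∣q∣ p q) (+-monoʳ-≤ ∣ p ∣ (n≤1+n ∣ q ∣)))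

p⊆q∧∣q∣≤∣p∣⇒p≡q : ∀ {m} {p q : Subset m} → p ⊆ q → ∣ q ∣ ≤ ∣ p ∣ → p ≡ q
p⊆q∧∣q∣≤∣p∣⇒p≡q {p = []}          {[]}          _   _ = refl
p⊆q∧∣q∣≤∣p∣⇒p≡q {p = outside ∷ p} {outside ∷ q} p⊆q q≤p =
  cong (outside ∷_) (p⊆q∧∣q∣≤∣p∣⇒p≡q (drop-∷-⊆ p⊆q) q≤p)
p⊆q∧∣q∣≤∣p∣⇒p≡q {p = outside ∷ p} {inside  ∷ q} p⊆q q<p =
  ⊥-elim (<⇒≱ q<p (p⊆q⇒∣p∣≤∣q∣ (drop-∷-⊆ p⊆q)))
p⊆q∧∣q∣≤∣p∣⇒p≡q {p = inside  ∷ p} {outside ∷ q} p⊆q _ with p⊆q here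
... | ()
p⊆q∧∣q∣≤∣p∣⇒p≡q {p = inside  ∷ p} {inside  ∷ q} p⊆q q≤p =
  cong (inside ∷_) (p⊆q∧∣q∣≤∣p∣⇒p≡q (drop-∷-⊆ p⊆q) (s≤s⁻¹ q≤p))

∣image∣≤∣S∣ : ∀ {a b} (f : Fin a → Fin b) (S : Subset a) → ∣ image f S ∣ ≤ ∣ S ∣
∣image∣≤∣S∣ {b = b} f [] = subst (∣ image f [] ∣ ≤_) (∣⊥∣≡0 b) (p⊆q⇒∣p∣≤∣q∣ image-empty)
  where
  image-empty : image f [] ⊆ ⊥
  image-empty y∈ with ∈-image⁻ f {S = []} y∈
  ... | () , _
∣image∣≤∣S∣ f (outside ∷ S) = ≤-trans (p⊆q⇒∣p∣≤∣q∣ image-tail) (∣image∣≤∣S∣ (f ∘ suc) S)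
  where
  image-tail : image f (outside ∷ S) ⊆ image (f ∘ suc) S
  image-tail y∈ with ∈-image⁻ f y∈
  ... | suc x , there x∈S , refl = ∈-image⁺ (f ∘ suc) x∈S
∣image∣≤∣S∣ f (inside ∷ S) = begin
  ∣ image f (inside ∷ S) ∣               ≤⟨ p⊆q⇒∣p∣≤∣q∣ image-cons ⟩
  ∣ ⁅ f zero ⁆ ∪ image (f ∘ suc) S ∣     ≤⟨ ∣p∪q∣≤∣p∣+∣q∣ ⁅ f zero ⁆ _ ⟩
  ∣ ⁅ f zero ⁆ ∣ + ∣ image (f ∘ suc) S ∣ ≡⟨ cong (_+ ∣ image (f ∘ suc) S ∣) (∣⁅x⁆∣≡1 (f zero)) ⟩
  suc ∣ image (f ∘ suc) S ∣              ≤⟨ s≤s (∣image∣≤∣S∣ (f ∘ suc) S) ⟩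
  suc ∣ S ∣                              ∎
  where
  open ≤-Reasoning
  image-cons : image f (inside ∷ S) ⊆ ⁅ f zero ⁆ ∪ image (f ∘ suc) S
  image-cons y∈ with ∈-image⁻ f y∈
  ... | zero  , _            , refl = p⊆p∪q _ (x∈⁅x⁆ (f zero))
  ... | suc x , there x∈S    , refl = q⊆p∪q ⁅ f zero ⁆ (image (f ∘ suc) S) (∈-image⁺ (f ∘ suc) x∈S)

module _ (H : Hypergraph) where

  independent? : (S : Subset (n H)) → Dec (Independent H S)
  independent? S = map′ (λ all e → All.lookup all) (λ ind → All.tabulate (ind _))
    (all? (λ e → ¬? (e ⊆? S)) (edges H))

  isEdge? : (S : Subset (n H)) → Dec (IsEdge H S)
  isEdge? S = ListMembership._∈?_ (≡-dec Bool._≟_) S (edges H)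

  independent-⊆ : ∀ {S T} → S ⊆ T → Independent H T → Independent H S
  independent-⊆ S⊆T indT e e∈H e⊆S = indT e e∈H (S⊆T ∘ e⊆S)

  nonEdge⇒independent : ∀ {r S} → Uniform r H → ∣ S ∣ ≤ r → ¬ IsEdge H S → Independent H S
  nonEdge⇒independent {S = S} uniform ∣S∣≤r S∉H e e∈H e⊆S =
    S∉H (subst (IsEdge H) (p⊆q∧∣q∣≤∣p∣⇒p≡q e⊆S ∣S∣≤∣e∣) e∈H)
    where
    ∣S∣≤∣e∣ : ∣ S ∣ ≤ ∣ e ∣
    ∣S∣≤∣e∣ = subst (∣ S ∣ ≤_) (sym (uniform e e∈H)) ∣S∣≤r

  saturated⇒maximal : ∀ {S} → Independent H S →
    (∀ x → x ∉ S → ¬ Independent H (S ∪ ⁅ x ⁆)) → MaximalIndependent H S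
  saturated⇒maximal {S} indS saturated = indS , λ T indT S⊆T → ⊆-antisym (T⊆S indT S⊆T) S⊆T
    where
    T⊆S : ∀ {T} → Independent H T → S ⊆ T → T ⊆ S
    T⊆S {T} indT S⊆T {x} x∈T with x ∈? S
    ... | yes x∈S = x∈S
    ... | no  x∉S = ⊥-elim (saturated x x∉S (independent-⊆ S∪x⊆T indT))
      where
      S∪x⊆T : S ∪ ⁅ x ⁆ ⊆ T
      S∪x⊆T y∈ with x∈p∪q⁻ S ⁅ x ⁆ y∈
      ... | inj₁ y∈S = S⊆T y∈S
      ... | inj₂ y∈x with refl ← x∈⁅y⁆⇒x≡y x y∈x = x∈T

  extend-to-maximal : ∀ {S} → Independent H S → ∃ λ I → MaximalIndependent H I × S ⊆ I
  extend-to-maximal {S} = go (⊃-wellFounded S)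
    where
    go : ∀ {S} → Acc _⊃_ S → Independent H S → ∃ λ I → MaximalIndependent H I × S ⊆ I
    go {S} (acc rec) indS with any? (λ x → ¬? (x ∈? S) ×-dec independent? (S ∪ ⁅ x ⁆))
    ... | no unextendable =
      S , saturated⇒maximal indS (λ x x∉S ind → unextendable (x , x∉S , ind)) , λ x∈S → x∈S
    ... | yes (x , x∉S , indS∪x) with go (rec S∪x⊃S) indS∪x
      where
      S∪x⊃S : (S ∪ ⁅ x ⁆) ⊃ S
      S∪x⊃S = p⊆p∪q ⁅ x ⁆ , x , q⊆p∪q S ⁅ x ⁆ (x∈⁅x⁆ x) , x∉S
    ...   | I , maxI , S∪x⊆I = I , maxI , S∪x⊆I ∘ p⊆p∪q ⁅ x ⁆

homomorphism⇒preimage-independent : ∀ {H F f I} → IsHomomorphism H F f →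
  Independent F I → Independent H (preimage f I)
homomorphism⇒preimage-independent {f = f} hom indI h h∈H h⊆f⁻¹I =
  indI (image f h) (hom h h∈H) (⊆preimage⇒image⊆ f h⊆f⁻¹I)

mainTheorem16 : (r : ℕ) (H F : Hypergraph) → Uniform r H → Uniform r F →
    (f : V H → V F) →
    IsHomomorphism H F f ⇔
      (∀ I → MaximalIndependent F I → Independent H (preimage f I))
mainTheorem16 r H F uniformH uniformF f =
  mk⇔ (λ hom I (indI , _) → homomorphism⇒preimage-independent hom indI) reflect
  where
  reflect : (∀ I → MaximalIndependent F I → Independent H (preimage f I)) → IsHomomorphism H F f
  reflect pullback h h∈H = decidable-stable (isEdge? F (image f h)) λ fh∉F →
    let ∣fh∣≤r = subst (∣ image f h ∣ ≤_) (uniformH h h∈H) (∣image∣≤∣S∣ f h)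
        I , maxI , fh⊆I = extend-to-maximal F (nonEdge⇒independent F uniformF ∣fh∣≤r fh∉F)
    in pullback I maxI h h∈H (image⊆⇒⊆preimage f fh⊆I)
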